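{- Let $T=T_{n,k}(n_0;n_1^{[b_1]},\ldots,n_s^{[b_s]})$ with $k\ge 2$. If $\Lambda(T)\le\Lambda(T')$ for every tree $T'$ on $n$ vertices with diameter 4, then $s\le 2$, and $n_2-n_1=1$ if $s=2$.
   Context: For a connected graph $G$ on $n$ vertices with diameter $d$, $W(G)$ is the sum of distances over all unordered pairs of vertices and $\Lambda(G)=\frac12 n(n-1)d-W(G)$. Every tree of diameter 4 has the following form: for integers $k\ge 2$, $n_0\ge 0$, the tree $T_{n,k}(n_0; n_1^{[b_1]},\ldots,n_s^{[b_s]})$ (with $1\le n_1<\cdots<n_s$, $b_i\ge1$, $\sum b_i=k$, $\sum b_in_i=n-n_0-k-1$) is obtained from the star with center $v_0$ and leaves $v_1,\ldots,v_k$ by attaching $n_0$ pendent vertices to $v_0$ and $m_i\ge 1$ pendent vertices to $v_i$ ($1\le i\le k$), where among $m_1,\ldots,m_k$ the value $n_j$ occurs exactly $b_j$ times. -}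

module Defs where

open import Data.Nat using (ℕ; zero; suc; _+_; _*_; _∸_; _⊔_; _/_)
open import Data.Fin using (Fin; _≟_)
open import Data.List using (List; []; _∷_; map; _++_; concatMap; foldr; length)
open import Data.Nat.ListAction using (sum)
open import Data.List using (allFin)
open import Data.Integer using (ℤ; +_; _-_)
open import Relation.Nullary using (yes; no)

-- The tree T_{n,k}(n₀; m₁,…,m_k): star with centre v₀ and leaves v₁,…,v_k,
-- n₀ pendent vertices attached to v₀ and m i pendent vertices attached to v_i.
-- Its vertices:
data Vtx (n₀ k : ℕ) (m : Fin k → ℕ) : Set where
  centre : Vtx n₀ k m
  leaf₀  : Fin n₀ → Vtx n₀ k m
  mid    : Fin k → Vtx n₀ k m
  leaf   : (i : Fin k) → Fin (m i) → Vtx n₀ k m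

dist : ∀ {n₀ k m} → Vtx n₀ k m → Vtx n₀ k m → ℕ
dist centre centre = 0
dist centre (leaf₀ _) = 1
dist centre (mid _) = 1
dist centre (leaf _ _) = 2
dist (leaf₀ _) centre = 1
dist (leaf₀ a) (leaf₀ b) with a ≟ b
... | yes _ = 0
... | no _ = 2
dist (leaf₀ _) (mid _) = 2
dist (leaf₀ _) (leaf _ _) = 3
dist (mid _) centre = 1
dist (mid _) (leaf₀ _) = 2
dist (mid i) (mid j) with i ≟ j
... | yes _ = 0
... | no _ = 2
dist (mid i) (leaf j _) with i ≟ j
... | yes _ = 1
... | no _ = 3
dist (leaf _ _) centre = 2
dist (leaf _ _) (leaf₀ _) = 3
dist (leaf i _) (mid j) with i ≟ j
... | yes _ = 1
... | no _ = 3
dist (leaf i x) (leaf j y) with i ≟ j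
... | no _ = 4
... | yes _ with Data.Nat._≟_ (Data.Fin.toℕ x) (Data.Fin.toℕ y)
...   | yes _ = 0
...   | no _ = 2

vertices : (n₀ k : ℕ) (m : Fin k → ℕ) → List (Vtx n₀ k m)
vertices n₀ k m =
  centre ∷ (map leaf₀ (allFin n₀) ++ map mid (allFin k)
            ++ concatMap (λ i → map (leaf i) (allFin (m i))) (allFin k))

order : (n₀ k : ℕ) (m : Fin k → ℕ) → ℕ
order n₀ k m = length (vertices n₀ k m)

pairSum : ∀ {A : Set} → (A → A → ℕ) → List A → ℕ
pairSum f [] = 0
pairSum f (x ∷ xs) = sum (map (f x) xs) + pairSum f xs

pairMax : ∀ {A : Set} → (A → A → ℕ) → List A → ℕ
pairMax f [] = 0
pairMax f (x ∷ xs) = foldr _⊔_ 0 (map (f x) xs) ⊔ pairMax f xs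

wiener : (n₀ k : ℕ) (m : Fin k → ℕ) → ℕ
wiener n₀ k m = pairSum dist (vertices n₀ k m)

diameter : (n₀ k : ℕ) (m : Fin k → ℕ) → ℕ
diameter n₀ k m = pairMax dist (vertices n₀ k m)

-- Λ(T) = ½ n (n-1) d − W(T)   (n(n-1) is even, so the division is exact)
Λ : (n₀ k : ℕ) (m : Fin k → ℕ) → ℤ
Λ n₀ k m = + ((order n₀ k m * (order n₀ k m ∸ 1) * diameter n₀ k m) / 2) - + wiener n₀ k m

module Submission where

-- Write M = Σ m_i for the number of vertices at depth 2.  Rooting the tree
-- at v₀, every distance satisfies  d(x,y) = depth x + depth y − 2·meet(x,y),
-- where meet(x,y) is the depth of the last common vertex of the root paths
-- of x and y.  Summing this identity over all pairs gives the closed form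
--
--     W(T) + Σ_i m_i (m_i + 1)  =  (n₀ + k + M) · (n₀ + k + 2M),
--
-- so for fixed n₀, k and M the Wiener index is maximal exactly when
-- Σ m_i² is minimal.  If m_j ≥ m_i + 2, moving one pendent vertex from v_j
-- to v_i keeps n, the diameter 4 and M, but strictly lowers Σ m_i (m_i+1),
-- hence strictly raises W and strictly lowers Λ.  So in a Λ-minimal tree
-- all m_i differ by at most one, which is the statement of lemma3.

open import Defs
open import Data.Nat using (ℕ; _≤_; _<_; suc)
open import Data.Fin using (Fin)
open import Data.Integer using () renaming (_≤_ to _≤ℤ_)
open import Data.Product using (_×_)
open import Data.Sum using (_⊎_)
open import Relation.Binary.PropositionalEquality using (_≡_)

open import Data.Nat using (zero; _+_; _*_; _∸_; _/_; _⊔_; pred; z≤n; s≤s; z<s; _≤?_; >-nonZero)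
  renaming (_≟_ to _≟ℕ_)
open import Data.Nat.Properties hiding (_≟_)
open import Data.Nat.Tactic.RingSolver using (solve-∀)
open import Data.Nat.ListAction using () renaming (sum to listSum)
open import Data.Nat.ListAction.Properties using (sum-++)
open import Data.Fin using (toℕ; fromℕ<; punchIn; _≟_) renaming (zero to fzero; suc to fsuc)
open import Data.Fin.Properties using (toℕ-injective; punchInᵢ≢i)
open import Data.Vec.Functional using (updateAt)
open import Data.Vec.Functional.Properties using (updateAt-updates; updateAt-minimal)
open import Data.List using (List; []; _∷_; map; _++_; concatMap; foldr; length; tabulate; allFin)
open import Data.List.Properties using (map-++; map-tabulate; map-cong)
open import Data.List.Membership.Propositional using (_∈_)
open import Data.List.Membership.Propositional.Properties
  using (∈-map⁺; ∈-++⁺ʳ; ∈-allFin; ∈-concatMap⁺)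
open import Data.List.Relation.Unary.Any using (here; there)
import Data.List.Relation.Unary.Any as Any
open import Data.Integer using (_⊖_; _-_) renaming (_<_ to _<ℤ_; +_ to ⁺_)
import Data.Integer.Properties as ℤ
open import Data.Product using (_,_)
open import Data.Sum using (inj₁; inj₂)
open import Data.Empty using (⊥; ⊥-elim)
open import Function using (_∘_; id)
open import Relation.Nullary using (Dec; yes; no; ¬_)
open import Relation.Binary.Definitions using (tri<; tri≈; tri>)
open import Relation.Binary.PropositionalEquality
  using (refl; sym; trans; cong; cong₂; subst; subst₂; _≢_; module ≡-Reasoning)
open import Algebra.Properties.Semiring.Sum +-*-semiring
  using (sum; sum-syntax; sum-cong-≗; ∑-distrib-+; *-distribˡ-sum; *-distribʳ-sum; sum-remove; sum-replicate-zero)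

open ≡-Reasoning

[_] : ∀ {p} {P : Set p} → Dec P → ℕ
[ yes _ ] = 1
[ no _ ] = 0

[]-yes : ∀ {p} {P : Set p} → P → (d : Dec P) → [ d ] ≡ 1
[]-yes _ (yes _) = refl
[]-yes p (no ¬p) = ⊥-elim (¬p p)

[]-no : ∀ {p} {P : Set p} → ¬ P → (d : Dec P) → [ d ] ≡ 0
[]-no ¬p (yes p) = ⊥-elim (¬p p)
[]-no _ (no _) = refl

[]-cong : ∀ {p q} {P : Set p} {Q : Set q} → (P → Q) → (Q → P) →
          (d : Dec P) (e : Dec Q) → [ d ] ≡ [ e ]
[]-cong _ _ (yes _) (yes _) = refl
[]-cong _ _ (no _) (no _) = refl
[]-cong f _ (yes p) (no ¬q) = ⊥-elim (¬q (f p))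
[]-cong _ g (no ¬p) (yes q) = ⊥-elim (¬p (g q))

∑-const : ∀ n c → ∑[ i < n ] c ≡ n * c
∑-const zero c = refl
∑-const (suc n) c = cong (c +_) (∑-const n c)

∑-update : ∀ {n} (f g : Fin n → ℕ) (i : Fin n) → (∀ j → j ≢ i → f j ≡ g j) →
           sum f + g i ≡ sum g + f i
∑-update {suc n} f g i agree = begin
  sum f + g i                     ≡⟨ cong (_+ g i) (sum-remove {i = i} f) ⟩
  f i + sum (f ∘ punchIn i) + g i ≡⟨ cong (λ s → f i + s + g i) rest ⟩
  f i + sum (g ∘ punchIn i) + g i ≡⟨ swap (f i) _ (g i) ⟩
  g i + sum (g ∘ punchIn i) + f i ≡⟨ cong (_+ f i) (sum-remove {i = i} g) ⟨
  sum g + f i                     ∎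
  where
  rest : sum (f ∘ punchIn i) ≡ sum (g ∘ punchIn i)
  rest = sum-cong-≗ (λ j → agree (punchIn i j) (punchInᵢ≢i i j))
  swap : ∀ a s b → a + s + b ≡ b + s + a
  swap = solve-∀

∑-single : ∀ {n} (f : Fin n → ℕ) (i : Fin n) → (∀ j → j ≢ i → f j ≡ 0) → sum f ≡ f i
∑-single {n} f i vanish = begin
  sum f                ≡⟨ +-identityʳ (sum f) ⟨
  sum f + 0            ≡⟨ ∑-update f (λ _ → 0) i vanish ⟩
  ∑[ j < n ] 0 + f i   ≡⟨ cong (_+ f i) (sum-replicate-zero n) ⟩
  f i                  ∎

∑-sift : ∀ {n} (i : Fin n) (h : Fin n → ℕ) → ∑[ j < n ] ([ i ≟ j ] * h j) ≡ h i
∑-sift i h = trans (∑-single _ i off) (trans (cong (_* h i) ([]-yes refl (i ≟ i))) (*-identityˡ (h i)))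
  where
  off : ∀ j → j ≢ i → [ i ≟ j ] * h j ≡ 0
  off j j≢i = cong (_* h j) ([]-no (j≢i ∘ sym) (i ≟ j))

∑-delta : ∀ {n} (i : Fin n) → ∑[ j < n ] [ i ≟ j ] ≡ 1
∑-delta i = trans (sum-cong-≗ (λ j → sym (*-identityʳ [ i ≟ j ]))) (∑-sift i (λ _ → 1))

listSum-map-+ : ∀ {A : Set} (f g : A → ℕ) xs →
                listSum (map (λ x → f x + g x) xs) ≡ listSum (map f xs) + listSum (map g xs)
listSum-map-+ f g [] = refl
listSum-map-+ f g (x ∷ xs) = trans (cong (f x + g x +_) (listSum-map-+ f g xs))
                                   (shuffle (f x) (g x) (listSum (map f xs)) (listSum (map g xs)))
  where
  shuffle : ∀ a b c d → a + b + (c + d) ≡ a + c + (b + d)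
  shuffle = solve-∀

listSum-map-const : ∀ {A : Set} (c : ℕ) xs → listSum (map (λ (_ : A) → c) xs) ≡ length xs * c
listSum-map-const c [] = refl
listSum-map-const c (x ∷ xs) = cong (c +_) (listSum-map-const c xs)

*-distribˡ-listSum : ∀ {A : Set} c (φ : A → ℕ) ys →
                     c * listSum (map φ ys) ≡ listSum (map (λ y → c * φ y) ys)
*-distribˡ-listSum c φ [] = *-zeroʳ c
*-distribˡ-listSum c φ (y ∷ ys) = trans (*-distribˡ-+ c (φ y) _) (cong (c * φ y +_) (*-distribˡ-listSum c φ ys))

listSum-map-cong : ∀ {A : Set} {f g : A → ℕ} → (∀ x → f x ≡ g x) → ∀ xs →
                   listSum (map f xs) ≡ listSum (map g xs)
listSum-map-cong f≡g xs = cong listSum (map-cong f≡g xs)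

listSum-map-++ : ∀ {A : Set} (g : A → ℕ) xs ys →
                 listSum (map g (xs ++ ys)) ≡ listSum (map g xs) + listSum (map g ys)
listSum-map-++ g xs ys = trans (cong listSum (map-++ g xs ys)) (sum-++ (map g xs) _)

listSum-tabulate : ∀ {A : Set} n (g : A → ℕ) (h : Fin n → A) →
                   listSum (map g (tabulate h)) ≡ ∑[ i < n ] g (h i)
listSum-tabulate zero g h = refl
listSum-tabulate (suc n) g h = cong (g (h fzero) +_) (listSum-tabulate n g (h ∘ fsuc))

listSum-concatMap : ∀ {A B : Set} (g : B → ℕ) (f : A → List B) xs →
                    listSum (map g (concatMap f xs)) ≡ listSum (map (λ x → listSum (map g (f x))) xs)
listSum-concatMap g f [] = refl
listSum-concatMap g f (x ∷ xs) =
  trans (listSum-map-++ g (f x) _) (cong (listSum (map g (f x)) +_) (listSum-concatMap g f xs))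

module _ {n₀ k : ℕ} {m : Fin k → ℕ} where

  depth : Vtx n₀ k m → ℕ
  depth centre = 0
  depth (leaf₀ _) = 1
  depth (mid _) = 1
  depth (leaf _ _) = 2

  meet : Vtx n₀ k m → Vtx n₀ k m → ℕ
  meet centre _ = 0
  meet (leaf₀ _) centre = 0
  meet (leaf₀ a) (leaf₀ b) = [ a ≟ b ]
  meet (leaf₀ _) (mid _) = 0
  meet (leaf₀ _) (leaf _ _) = 0
  meet (mid _) centre = 0
  meet (mid _) (leaf₀ _) = 0
  meet (mid i) (mid j) = [ i ≟ j ]
  meet (mid i) (leaf j _) = [ i ≟ j ]
  meet (leaf _ _) centre = 0
  meet (leaf _ _) (leaf₀ _) = 0
  meet (leaf i _) (mid j) = [ i ≟ j ]
  meet (leaf i x) (leaf j y) = [ i ≟ j ] * (1 + [ toℕ x ≟ℕ toℕ y ])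

  below : Vtx n₀ k m → ℕ
  below centre = 0
  below (leaf₀ _) = 0
  below (mid i) = m i
  below (leaf i _) = m i

  dist-meet : ∀ x y → dist x y + 2 * meet x y ≡ depth x + depth y
  dist-meet centre centre = refl
  dist-meet centre (leaf₀ _) = refl
  dist-meet centre (mid _) = refl
  dist-meet centre (leaf _ _) = refl
  dist-meet (leaf₀ _) centre = refl
  dist-meet (leaf₀ a) (leaf₀ b) with a ≟ b
  ... | yes _ = refl
  ... | no _ = refl
  dist-meet (leaf₀ _) (mid _) = refl
  dist-meet (leaf₀ _) (leaf _ _) = refl
  dist-meet (mid _) centre = refl
  dist-meet (mid _) (leaf₀ _) = refl
  dist-meet (mid i) (mid j) with i ≟ j
  ... | yes _ = refl
  ... | no _ = refl
  dist-meet (mid i) (leaf j _) with i ≟ j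
  ... | yes _ = refl
  ... | no _ = refl
  dist-meet (leaf _ _) centre = refl
  dist-meet (leaf _ _) (leaf₀ _) = refl
  dist-meet (leaf i _) (mid j) with i ≟ j
  ... | yes _ = refl
  ... | no _ = refl
  dist-meet (leaf i x) (leaf j y) with i ≟ j
  ... | no _ = refl
  ... | yes _ with toℕ x ≟ℕ toℕ y
  ...   | yes _ = refl
  ...   | no _ = refl

  meet-sym : ∀ x y → meet x y ≡ meet y x
  meet-sym centre centre = refl
  meet-sym centre (leaf₀ _) = refl
  meet-sym centre (mid _) = refl
  meet-sym centre (leaf _ _) = refl
  meet-sym (leaf₀ _) centre = refl
  meet-sym (leaf₀ a) (leaf₀ b) = []-cong sym sym (a ≟ b) (b ≟ a)
  meet-sym (leaf₀ _) (mid _) = refl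
  meet-sym (leaf₀ _) (leaf _ _) = refl
  meet-sym (mid _) centre = refl
  meet-sym (mid _) (leaf₀ _) = refl
  meet-sym (mid i) (mid j) = []-cong sym sym (i ≟ j) (j ≟ i)
  meet-sym (mid i) (leaf j _) = []-cong sym sym (i ≟ j) (j ≟ i)
  meet-sym (leaf _ _) centre = refl
  meet-sym (leaf _ _) (leaf₀ _) = refl
  meet-sym (leaf i _) (mid j) = []-cong sym sym (i ≟ j) (j ≟ i)
  meet-sym (leaf i x) (leaf j y) =
    cong₂ (λ s t → s * (1 + t)) ([]-cong sym sym (i ≟ j) (j ≟ i))
                                ([]-cong sym sym (toℕ x ≟ℕ toℕ y) (toℕ y ≟ℕ toℕ x))

  meet-self : ∀ x → meet x x ≡ depth x
  meet-self centre = refl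
  meet-self (leaf₀ a) = []-yes refl (a ≟ a)
  meet-self (mid i) = []-yes refl (i ≟ i)
  meet-self (leaf i x) =
    cong₂ (λ s t → s * (1 + t)) ([]-yes refl (i ≟ i)) ([]-yes refl (toℕ x ≟ℕ toℕ x))

  dist-sym : ∀ x y → dist x y ≡ dist y x
  dist-sym x y = +-cancelʳ-≡ (2 * meet x y) (dist x y) (dist y x) (begin
    dist x y + 2 * meet x y ≡⟨ dist-meet x y ⟩
    depth x + depth y       ≡⟨ +-comm (depth x) (depth y) ⟩
    depth y + depth x       ≡⟨ dist-meet y x ⟨
    dist y x + 2 * meet y x ≡⟨ cong (λ t → dist y x + 2 * t) (meet-sym y x) ⟩
    dist y x + 2 * meet x y ∎)

  depth≤2 : ∀ x → depth x ≤ 2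
  depth≤2 centre = z≤n
  depth≤2 (leaf₀ _) = s≤s z≤n
  depth≤2 (mid _) = s≤s z≤n
  depth≤2 (leaf _ _) = ≤-refl

  dist≤4 : ∀ x y → dist x y ≤ 4
  dist≤4 x y = ≤-trans (m≤m+n (dist x y) (2 * meet x y))
    (≤-trans (≤-reflexive (dist-meet x y)) (+-mono-≤ (depth≤2 x) (depth≤2 y)))

  dist-leaves : ∀ {i j : Fin k} {x : Fin (m i)} {y : Fin (m j)} → i ≢ j →
                dist {n₀} (leaf i x) (leaf j y) ≡ 4
  dist-leaves {i} {j} i≢j with i ≟ j
  ... | yes i≡j = ⊥-elim (i≢j i≡j)
  ... | no _ = refl

pairSum-linear : ∀ {A : Set} (f g h : A → A → ℕ) c → (∀ x y → f x y + c * g x y ≡ h x y) →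
                 ∀ xs → pairSum f xs + c * pairSum g xs ≡ pairSum h xs
pairSum-linear f g h c fgh [] = *-zeroʳ c
pairSum-linear {A} f g h c fgh (x ∷ xs) = begin
  F + P f + c * (G + P g)          ≡⟨ shuffle F (P f) c G (P g) ⟩
  (F + c * G) + (P f + c * P g)    ≡⟨ cong₂ _+_ row (pairSum-linear f g h c fgh xs) ⟩
  listSum (map (h x) xs) + P h     ∎
  where
  P : (A → A → ℕ) → ℕ
  P φ = pairSum φ xs
  F G : ℕ
  F = listSum (map (f x) xs)
  G = listSum (map (g x) xs)
  shuffle : ∀ a b c d e → a + b + c * (d + e) ≡ (a + c * d) + (b + c * e)
  shuffle = solve-∀
  row : F + c * G ≡ listSum (map (h x) xs)
  row = begin
    F + c * G                                ≡⟨ cong (F +_) (*-distribˡ-listSum c (g x) xs) ⟩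
    F + listSum (map (λ y → c * g x y) xs)   ≡⟨ listSum-map-+ (f x) (λ y → c * g x y) xs ⟨
    listSum (map (λ y → f x y + c * g x y) xs) ≡⟨ listSum-map-cong (fgh x) xs ⟩
    listSum (map (h x) xs)                   ∎

pairSum-depths : ∀ {A : Set} (d : A → ℕ) xs →
                 pairSum (λ x y → d x + d y) xs + listSum (map d xs) ≡ length xs * listSum (map d xs)
pairSum-depths d [] = refl
pairSum-depths d (x ∷ xs) = begin
  listSum (map (λ y → d x + d y) xs) + P + (d x + S)
    ≡⟨ cong (λ t → t + P + (d x + S)) (listSum-map-+ (λ _ → d x) d xs) ⟩
  listSum (map (λ _ → d x) xs) + S + P + (d x + S)
    ≡⟨ cong (λ t → t + S + P + (d x + S)) (listSum-map-const (d x) xs) ⟩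
  length xs * d x + S + P + (d x + S)
    ≡⟨ shuffle (length xs * d x) S P (d x) ⟩
  length xs * d x + d x + S + (P + S)
    ≡⟨ cong (length xs * d x + d x + S +_) (pairSum-depths d xs) ⟩
  length xs * d x + d x + S + length xs * S
    ≡⟨ collect (length xs) (d x) S ⟩
  suc (length xs) * (d x + S) ∎
  where
  P S : ℕ
  P = pairSum (λ x y → d x + d y) xs
  S = listSum (map d xs)
  shuffle : ∀ a s p e → a + s + p + (e + s) ≡ a + e + s + (p + s)
  shuffle = solve-∀
  collect : ∀ l e s → l * e + e + s + l * s ≡ suc l * (e + s)
  collect = solve-∀

pairSum-double : ∀ {A : Set} (f : A → A → ℕ) → (∀ x y → f x y ≡ f y x) → ∀ xs →
                 2 * pairSum f xs + listSum (map (λ x → f x x) xs)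
                 ≡ listSum (map (λ x → listSum (map (f x) xs)) xs)
pairSum-double f f-sym [] = refl
pairSum-double f f-sym (x ∷ xs) = begin
  2 * (R + P) + (f x x + D)        ≡⟨ shuffle R P (f x x) D ⟩
  f x x + R + (R + (2 * P + D))    ≡⟨ cong (λ t → f x x + R + (R + t)) (pairSum-double f f-sym xs) ⟩
  f x x + R + (R + Rows)           ≡⟨ cong (λ t → f x x + R + (t + Rows)) (listSum-map-cong (f-sym x) xs) ⟩
  f x x + R + (listSum (map (λ y → f y x) xs) + Rows)
    ≡⟨ cong (f x x + R +_) (listSum-map-+ (λ y → f y x) (λ y → listSum (map (f y) xs)) xs) ⟨
  f x x + R + listSum (map (λ y → f y x + listSum (map (f y) xs)) xs) ∎
  where
  R P D Rows : ℕ
  R = listSum (map (f x) xs)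
  P = pairSum f xs
  D = listSum (map (λ y → f y y) xs)
  Rows = listSum (map (λ y → listSum (map (f y) xs)) xs)
  shuffle : ∀ r p e d → 2 * (r + p) + (e + d) ≡ e + r + (r + (2 * p + d))
  shuffle = solve-∀

foldr-⊔-≤ : ∀ {A : Set} (g : A → ℕ) c → (∀ y → g y ≤ c) → ∀ xs → foldr _⊔_ 0 (map g xs) ≤ c
foldr-⊔-≤ g c bound [] = z≤n
foldr-⊔-≤ g c bound (x ∷ xs) = ⊔-lub (bound x) (foldr-⊔-≤ g c bound xs)

foldr-⊔-≥ : ∀ {A : Set} (g : A → ℕ) {y} xs → y ∈ xs → g y ≤ foldr _⊔_ 0 (map g xs)
foldr-⊔-≥ g (x ∷ xs) (here refl) = m≤m⊔n _ _
foldr-⊔-≥ g (x ∷ xs) (there y∈xs) = ≤-trans (foldr-⊔-≥ g xs y∈xs) (m≤n⊔m (g x) _)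

pairMax-≤ : ∀ {A : Set} (f : A → A → ℕ) c → (∀ x y → f x y ≤ c) → ∀ xs → pairMax f xs ≤ c
pairMax-≤ f c bound [] = z≤n
pairMax-≤ f c bound (x ∷ xs) = ⊔-lub (foldr-⊔-≤ (f x) c (bound x) xs) (pairMax-≤ f c bound xs)

pairMax-≥ : ∀ {A : Set} (f : A → A → ℕ) → (∀ x y → f x y ≡ f y x) →
            ∀ xs {x y} → x ∈ xs → y ∈ xs → x ≢ y → f x y ≤ pairMax f xs
pairMax-≥ f f-sym (z ∷ xs) (here refl) (here refl) x≢y = ⊥-elim (x≢y refl)
pairMax-≥ f f-sym (z ∷ xs) (here refl) (there y∈xs) _ =
  ≤-trans (foldr-⊔-≥ (f z) xs y∈xs) (m≤m⊔n _ _)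
pairMax-≥ f f-sym (z ∷ xs) {x} (there x∈xs) (here refl) _ =
  ≤-trans (≤-reflexive (f-sym x z)) (≤-trans (foldr-⊔-≥ (f z) xs x∈xs) (m≤m⊔n _ _))
pairMax-≥ f f-sym (z ∷ xs) (there x∈xs) (there y∈xs) x≢y =
  ≤-trans (pairMax-≥ f f-sym xs x∈xs y∈xs x≢y) (m≤n⊔m _ _)

-- Twice the number of unordered pairs of vertices inside a common branch
-- {v_i} ∪ {pendent vertices at v_i}.
branchPairs : ∀ {k} → (Fin k → ℕ) → ℕ
branchPairs {k} m = ∑[ i < k ] (m i * suc (m i))

module _ (n₀ k : ℕ) (m : Fin k → ℕ) where

  private
    V : Set
    V = Vtx n₀ k m
    M : ℕ
    M = ∑[ i < k ] m i

  ∑V : (V → ℕ) → ℕ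
  ∑V g = listSum (map g (vertices n₀ k m))

  ∑V-split : ∀ g → ∑V g ≡ g centre + (∑[ a < n₀ ] g (leaf₀ a) + (∑[ i < k ] g (mid i)
                                       + ∑[ i < k ] ∑[ y < m i ] g (leaf i y)))
  ∑V-split g = cong (g centre +_) (begin
    listSum (map g (L₀ ++ Lmid ++ Lleaf))
      ≡⟨ listSum-map-++ g L₀ _ ⟩
    listSum (map g L₀) + listSum (map g (Lmid ++ Lleaf))
      ≡⟨ cong (listSum (map g L₀) +_) (listSum-map-++ g Lmid Lleaf) ⟩
    listSum (map g L₀) + (listSum (map g Lmid) + listSum (map g Lleaf))
      ≡⟨ cong₂ (λ s t → s + (t + listSum (map g Lleaf))) (over-allFin n₀ leaf₀) (over-allFin k mid) ⟩
    ∑[ a < n₀ ] g (leaf₀ a) + (∑[ i < k ] g (mid i) + listSum (map g Lleaf))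
      ≡⟨ cong (λ t → ∑[ a < n₀ ] g (leaf₀ a) + (∑[ i < k ] g (mid i) + t)) leaves ⟩
    ∑[ a < n₀ ] g (leaf₀ a) + (∑[ i < k ] g (mid i) + ∑[ i < k ] ∑[ y < m i ] g (leaf i y)) ∎)
    where
    L₀ Lmid Lleaf : List V
    L₀ = map leaf₀ (allFin n₀)
    Lmid = map mid (allFin k)
    Lleaf = concatMap (λ i → map (leaf i) (allFin (m i))) (allFin k)
    over-allFin : ∀ n (h : Fin n → V) → listSum (map g (map h (allFin n))) ≡ ∑[ i < n ] g (h i)
    over-allFin n h = trans (cong (listSum ∘ map g) (map-tabulate id h)) (listSum-tabulate n g h)
    leaves : listSum (map g Lleaf) ≡ ∑[ i < k ] ∑[ y < m i ] g (leaf i y)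
    leaves = trans (listSum-concatMap g _ (allFin k))
               (trans (listSum-tabulate k _ id) (sum-cong-≗ (λ i → over-allFin (m i) (leaf i))))

  ∑V-kindwise : ∀ g c₁ c₂ c₃ → (∀ a → g (leaf₀ a) ≡ c₁) → (∀ i → g (mid i) ≡ c₂) →
                (∀ i y → g (leaf i y) ≡ c₃) → ∑V g ≡ g centre + (n₀ * c₁ + (k * c₂ + M * c₃))
  ∑V-kindwise g c₁ c₂ c₃ e₁ e₂ e₃ = trans (∑V-split g) (cong (g centre +_) (cong₂ _+_
    (trans (sum-cong-≗ e₁) (∑-const n₀ c₁)) (cong₂ _+_
    (trans (sum-cong-≗ e₂) (∑-const k c₂))
    (begin
      ∑[ i < k ] ∑[ y < m i ] g (leaf i y) ≡⟨ sum-cong-≗ (λ i → trans (sum-cong-≗ (e₃ i)) (∑-const (m i) c₃)) ⟩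
      ∑[ i < k ] (m i * c₃)              ≡⟨ *-distribʳ-sum c₃ m ⟨
      M * c₃                               ∎))))

  order-formula : order n₀ k m ≡ suc (n₀ + (k + M))
  order-formula = begin
    length (vertices n₀ k m)                ≡⟨ *-identityʳ _ ⟨
    length (vertices n₀ k m) * 1            ≡⟨ listSum-map-const 1 (vertices n₀ k m) ⟨
    ∑V (λ _ → 1)                            ≡⟨ ∑V-kindwise (λ _ → 1) 1 1 1 (λ _ → refl) (λ _ → refl) (λ _ _ → refl) ⟩
    1 + (n₀ * 1 + (k * 1 + M * 1))          ≡⟨ cong₂ (λ a b → 1 + (a + b)) (*-identityʳ n₀)
                                                 (cong₂ _+_ (*-identityʳ k) (*-identityʳ M)) ⟩
    suc (n₀ + (k + M))                      ∎

  depth-total : ∑V depth ≡ n₀ + (k + 2 * M)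
  depth-total = trans (∑V-kindwise depth 1 1 2 (λ _ → refl) (λ _ → refl) (λ _ _ → refl))
    (cong₂ _+_ (*-identityʳ n₀) (cong₂ _+_ (*-identityʳ k) (*-comm M 2)))

  no-leaves : ∑[ i < k ] ∑[ y < m i ] 0 ≡ 0
  no-leaves = trans (sum-cong-≗ (λ i → sum-replicate-zero (m i))) (sum-replicate-zero k)

  -- Row sums of meet: Σ_y meet(x,y) counts, for each non-root vertex z on the
  -- root path of x, the vertices below z.
  meet-row : ∀ x → ∑V (meet x) ≡ depth x + below x
  meet-row centre = trans (∑V-split (meet centre))
    (cong₂ _+_ (sum-replicate-zero n₀) (cong₂ _+_ (sum-replicate-zero k) no-leaves))
  meet-row (leaf₀ a) = trans (∑V-split (meet (leaf₀ a)))
    (cong₂ _+_ (∑-delta a) (cong₂ _+_ (sum-replicate-zero k) no-leaves))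
  meet-row (mid i) = trans (∑V-split (meet (mid i)))
    (cong₂ _+_ (sum-replicate-zero n₀) (cong₂ _+_ (∑-delta i) (begin
      ∑[ j < k ] ∑[ y < m j ] [ i ≟ j ] ≡⟨ sum-cong-≗ (λ j → trans (∑-const (m j) _) (*-comm (m j) _)) ⟩
      ∑[ j < k ] ([ i ≟ j ] * m j)     ≡⟨ ∑-sift i m ⟩
      m i                               ∎)))
  meet-row (leaf i y) = trans (∑V-split (meet (leaf i y)))
    (trans (cong₂ _+_ (sum-replicate-zero n₀) (cong₂ _+_ (∑-delta i) same-branch))
      (cong suc (+-comm (m i) 1)))
    where
    own : ∑[ z < m i ] [ toℕ y ≟ℕ toℕ z ] ≡ 1
    own = trans (sum-cong-≗ (λ z → []-cong toℕ-injective (cong toℕ) (toℕ y ≟ℕ toℕ z) (y ≟ z))) (∑-delta y)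
    same-branch : ∑[ j < k ] ∑[ z < m j ] meet {n₀} {k} {m} (leaf i y) (leaf j z) ≡ m i + 1
    same-branch = begin
      ∑[ j < k ] ∑[ z < m j ] ([ i ≟ j ] * (1 + [ toℕ y ≟ℕ toℕ z ]))
        ≡⟨ sum-cong-≗ (λ j → *-distribˡ-sum {m j} [ i ≟ j ] (λ z → 1 + [ toℕ y ≟ℕ toℕ z ])) ⟨
      ∑[ j < k ] ([ i ≟ j ] * ∑[ z < m j ] (1 + [ toℕ y ≟ℕ toℕ z ]))
        ≡⟨ ∑-sift i (λ j → ∑[ z < m j ] (1 + [ toℕ y ≟ℕ toℕ z ])) ⟩
      ∑[ z < m i ] (1 + [ toℕ y ≟ℕ toℕ z ])
        ≡⟨ ∑-distrib-+ {m i} (λ _ → 1) (λ z → [ toℕ y ≟ℕ toℕ z ]) ⟩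
      ∑[ z < m i ] 1 + ∑[ z < m i ] [ toℕ y ≟ℕ toℕ z ]
        ≡⟨ cong₂ _+_ (trans (∑-const (m i) 1) (*-identityʳ (m i))) own ⟩
      m i + 1 ∎

  below-total : ∑V below ≡ branchPairs m
  below-total = begin
    ∑V below
      ≡⟨ ∑V-split below ⟩
    0 + (∑[ a < n₀ ] 0 + (∑[ i < k ] m i + ∑[ i < k ] ∑[ y < m i ] m i))
      ≡⟨ cong₂ (λ s t → s + (M + t)) (sum-replicate-zero n₀)
                 (sum-cong-≗ (λ i → ∑-const (m i) (m i))) ⟩
    ∑[ i < k ] m i + ∑[ i < k ] (m i * m i)
      ≡⟨ ∑-distrib-+ m (λ i → m i * m i) ⟨
    ∑[ i < k ] (m i + m i * m i)
      ≡⟨ sum-cong-≗ (λ i → sym (*-suc (m i) (m i))) ⟩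
    branchPairs m ∎

  -- Each unordered pair within a common branch has meet 1, all others 0.
  meet-pairs : 2 * pairSum meet (vertices n₀ k m) ≡ branchPairs m
  meet-pairs = +-cancelʳ-≡ (∑V depth) _ _ (begin
    2 * pairSum meet vs + ∑V depth         ≡⟨ cong (2 * pairSum meet vs +_) (listSum-map-cong meet-self vs) ⟨
    2 * pairSum meet vs + ∑V (λ x → meet x x) ≡⟨ pairSum-double meet meet-sym vs ⟩
    ∑V (λ x → ∑V (meet x))                 ≡⟨ listSum-map-cong meet-row vs ⟩
    ∑V (λ x → depth x + below x)           ≡⟨ listSum-map-+ depth below vs ⟩
    ∑V depth + ∑V below                    ≡⟨ cong (∑V depth +_) below-total ⟩
    ∑V depth + branchPairs m               ≡⟨ +-comm (∑V depth) _ ⟩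
    branchPairs m + ∑V depth               ∎)
    where
    vs : List V
    vs = vertices n₀ k m

  wiener-formula : wiener n₀ k m + branchPairs m ≡ (n₀ + k + M) * (n₀ + k + 2 * M)
  wiener-formula = +-cancelʳ-≡ (∑V depth) _ _ (begin
    W + branchPairs m + ∑V depth
      ≡⟨ cong (λ t → W + t + ∑V depth) meet-pairs ⟨
    W + 2 * pairSum meet vs + ∑V depth
      ≡⟨ cong (_+ ∑V depth) (pairSum-linear dist meet _ 2 dist-meet vs) ⟩
    pairSum (λ x y → depth x + depth y) vs + ∑V depth
      ≡⟨ pairSum-depths depth vs ⟩
    length vs * ∑V depth
      ≡⟨ cong₂ _*_ order-formula depth-total ⟩
    suc (n₀ + (k + M)) * (n₀ + (k + 2 * M))
      ≡⟨ expand n₀ k M ⟩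
    (n₀ + k + M) * (n₀ + k + 2 * M) + (n₀ + (k + 2 * M))
      ≡⟨ cong ((n₀ + k + M) * (n₀ + k + 2 * M) +_) depth-total ⟨
    (n₀ + k + M) * (n₀ + k + 2 * M) + ∑V depth ∎)
    where
    vs : List V
    vs = vertices n₀ k m
    W : ℕ
    W = wiener n₀ k m
    expand : ∀ a b c → suc (a + (b + c)) * (a + (b + 2 * c)) ≡ (a + b + c) * (a + b + 2 * c) + (a + (b + 2 * c))
    expand = solve-∀

diameter-four : ∀ n₀ k (m : Fin k → ℕ) → 2 ≤ k → (∀ i → 1 ≤ m i) → diameter n₀ k m ≡ 4
diameter-four n₀ (suc zero) m (s≤s ()) _
diameter-four n₀ (suc (suc k)) m _ m≥1 = ≤-antisym (pairMax-≤ dist 4 dist≤4 vs)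
  (≤-trans (≤-reflexive (sym (dist-leaves {n₀} {suc (suc k)} {m} {fzero} {fsuc fzero} {x} {y} (λ ()))))
           (pairMax-≥ dist dist-sym vs (leaf-∈ fzero x) (leaf-∈ (fsuc fzero) y) (λ ())))
  where
  vs : List (Vtx n₀ (suc (suc k)) m)
  vs = vertices n₀ (suc (suc k)) m
  x : Fin (m fzero)
  x = fromℕ< (m≥1 fzero)
  y : Fin (m (fsuc fzero))
  y = fromℕ< (m≥1 (fsuc fzero))
  leaf-∈ : ∀ l z → leaf l z ∈ vs
  leaf-∈ l z = there (∈-++⁺ʳ (map leaf₀ (allFin n₀)) (∈-++⁺ʳ (map mid (allFin (suc (suc k))))
    (∈-concatMap⁺ (λ l → map (leaf l) (allFin (m l)))
      (Any.map (λ { refl → ∈-map⁺ (leaf l) (∈-allFin z) }) (∈-allFin l)))))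

transfer : ∀ {k} → (Fin k → ℕ) → Fin k → Fin k → Fin k → ℕ
transfer m i j = updateAt (updateAt m j pred) i suc

gap⇒≢ : ∀ {k} (m : Fin k → ℕ) {i j} → suc (m i) < m j → i ≢ j
gap⇒≢ m {i} gap refl = <-irrefl refl (<-trans (n<1+n (m i)) gap)

module _ {k} (m : Fin k → ℕ) {i j : Fin k} (i≢j : i ≢ j) where

  private
    m₁ : Fin k → ℕ
    m₁ = updateAt m j pred

  transfer-i : transfer m i j i ≡ suc (m i)
  transfer-i = trans (updateAt-updates i m₁) (cong suc (updateAt-minimal i j m i≢j))

  transfer-j : transfer m i j j ≡ pred (m j)
  transfer-j = trans (updateAt-minimal j i m₁ (i≢j ∘ sym)) (updateAt-updates j m)

  transfer-other : ∀ l → l ≢ i → l ≢ j → transfer m i j l ≡ m l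
  transfer-other l l≢i l≢j = trans (updateAt-minimal l i m₁ l≢i) (updateAt-minimal l j m l≢j)

  transfer-positive : (∀ l → 1 ≤ m l) → 2 ≤ m j → ∀ l → 1 ≤ transfer m i j l
  transfer-positive m≥1 m[j]≥2 l with l ≟ i | l ≟ j
  ... | yes refl | _ = subst (1 ≤_) (sym transfer-i) (s≤s z≤n)
  ... | no _ | yes refl = subst (1 ≤_) (sym transfer-j) (<⇒≤pred m[j]≥2)
  ... | no l≢i | no l≢j = subst (1 ≤_) (sym (transfer-other l l≢i l≢j)) (m≥1 l)

  ∑-transfer : ∀ (φ : ℕ → ℕ) →
               sum (φ ∘ transfer m i j) + (φ (m i) + φ (m j))
               ≡ sum (φ ∘ m) + (φ (suc (m i)) + φ (pred (m j)))
  ∑-transfer φ = begin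
    sum (φ ∘ m′) + (φ (m i) + φ (m j))
      ≡⟨ cong (λ t → sum (φ ∘ m′) + (φ t + φ (m j))) (updateAt-minimal i j m i≢j) ⟨
    sum (φ ∘ m′) + (φ (m₁ i) + φ (m j))
      ≡⟨ shuffle (sum (φ ∘ m′)) (φ (m₁ i)) (φ (m j)) ⟩
    sum (φ ∘ m′) + φ (m₁ i) + φ (m j)
      ≡⟨ cong (_+ φ (m j)) (∑-update (φ ∘ m′) (φ ∘ m₁) i (λ l l≢i → cong φ (updateAt-minimal l i m₁ l≢i))) ⟩
    sum (φ ∘ m₁) + φ (m′ i) + φ (m j)
      ≡⟨ +-comm-under (sum (φ ∘ m₁)) (φ (m′ i)) (φ (m j)) ⟩
    sum (φ ∘ m₁) + φ (m j) + φ (m′ i)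
      ≡⟨ cong (_+ φ (m′ i)) (∑-update (φ ∘ m₁) (φ ∘ m) j (λ l l≢j → cong φ (updateAt-minimal l j m l≢j))) ⟩
    sum (φ ∘ m) + φ (m₁ j) + φ (m′ i)
      ≡⟨ cong₂ (λ s t → sum (φ ∘ m) + φ s + φ t) (updateAt-updates j m) transfer-i ⟩
    sum (φ ∘ m) + φ (pred (m j)) + φ (suc (m i))
      ≡⟨ +-comm-under (sum (φ ∘ m)) (φ (pred (m j))) (φ (suc (m i))) ⟩
    sum (φ ∘ m) + φ (suc (m i)) + φ (pred (m j))
      ≡⟨ shuffle (sum (φ ∘ m)) (φ (suc (m i))) (φ (pred (m j))) ⟨
    sum (φ ∘ m) + (φ (suc (m i)) + φ (pred (m j))) ∎
    where
    m′ : Fin k → ℕ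
    m′ = transfer m i j
    shuffle : ∀ a b c → a + (b + c) ≡ a + b + c
    shuffle = solve-∀
    +-comm-under : ∀ a b c → a + b + c ≡ a + c + b
    +-comm-under = solve-∀

  transfer-total : 1 ≤ m j → sum (transfer m i j) ≡ sum m
  transfer-total m[j]≥1 = +-cancelʳ-≡ (m i + m j) _ _ (trans (∑-transfer id)
    (cong (sum m +_) (trans (sym (+-suc (m i) (pred (m j)))) (cong (m i +_) (suc-pred (m j) {{>-nonZero m[j]≥1}})))))

  transfer-branchPairs : suc (m i) < m j → branchPairs (transfer m i j) < branchPairs m
  transfer-branchPairs gap = +-cancelʳ-< (φ (m i) + φ (m j)) _ _
    (subst (_< branchPairs m + (φ (m i) + φ (m j))) (sym (∑-transfer φ))
           (+-monoʳ-< (branchPairs m) (exchange gap)))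
    where
    φ : ℕ → ℕ
    φ x = x * suc x
    expand : ∀ a d → suc a * suc (suc a) + (suc a + d) * suc (suc a + d) + (2 + 2 * d)
                     ≡ a * suc a + suc (suc a + d) * suc (suc (suc a + d))
    expand = solve-∀
    -- Convexity of φ: moving a unit from the larger to the smaller argument helps.
    exchange : ∀ {a b} → suc a < b → φ (suc a) + φ (pred b) < φ a + φ b
    exchange {a} {suc c} (s≤s a<c) with m≤n⇒∃[o]m+o≡n a<c
    ... | d , refl = subst (φ (suc a) + φ (suc a + d) <_) (expand a d) (m<m+n _ {2 + 2 * d} z<s)

module _ (n₀ : ℕ) {k} (m : Fin k → ℕ) {i j : Fin k} (gap : suc (m i) < m j) where

  private
    same-total : sum (transfer m i j) ≡ sum m
    same-total = transfer-total m (gap⇒≢ m gap) (≤-trans (s≤s z≤n) (<⇒≤ gap))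

  transfer-order : order n₀ k (transfer m i j) ≡ order n₀ k m
  transfer-order = begin
    order n₀ k (transfer m i j)         ≡⟨ order-formula n₀ k (transfer m i j) ⟩
    suc (n₀ + (k + sum (transfer m i j))) ≡⟨ cong (λ t → suc (n₀ + (k + t))) same-total ⟩
    suc (n₀ + (k + sum m))              ≡⟨ order-formula n₀ k m ⟨
    order n₀ k m                        ∎

  transfer-wiener : wiener n₀ k m < wiener n₀ k (transfer m i j)
  transfer-wiener = trade (begin
    wiener n₀ k m + branchPairs m                 ≡⟨ wiener-formula n₀ k m ⟩
    (n₀ + k + sum m) * (n₀ + k + 2 * sum m)       ≡⟨ cong (λ t → (n₀ + k + t) * (n₀ + k + 2 * t)) same-total ⟨
    (n₀ + k + sum m′) * (n₀ + k + 2 * sum m′)     ≡⟨ wiener-formula n₀ k m′ ⟨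
    wiener n₀ k m′ + branchPairs m′               ∎) (transfer-branchPairs m (gap⇒≢ m gap) gap)
    where
    m′ : Fin k → ℕ
    m′ = transfer m i j
    trade : ∀ {a b a′ b′} → a + b ≡ a′ + b′ → b′ < b → a < a′
    trade {a} {b} {a′} {b′} e b′<b = +-cancelʳ-< b′ a a′ (subst (a + b′ <_) e (+-monoʳ-< a b′<b))

Λ-decreases : ∀ {n₀ k m n₀′ k′ m′} → order n₀′ k′ m′ ≡ order n₀ k m →
              diameter n₀′ k′ m′ ≡ diameter n₀ k m →
              wiener n₀ k m < wiener n₀′ k′ m′ → Λ n₀′ k′ m′ <ℤ Λ n₀ k m
Λ-decreases {n₀} {k} {m} {n₀′} {k′} {m′} same-order same-diameter W<W′ =
  subst₂ _<ℤ_ (sym Λ′-form) (sym Λ-form) (ℤ.⊖-monoʳ->-< c W<W′)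
  where
  o c : ℕ
  o = order n₀ k m
  c = (o * (o ∸ 1) * diameter n₀ k m) / 2
  Λ-form : Λ n₀ k m ≡ c ⊖ wiener n₀ k m
  Λ-form = ℤ.m-n≡m⊖n c (wiener n₀ k m)
  Λ′-form : Λ n₀′ k′ m′ ≡ c ⊖ wiener n₀′ k′ m′
  Λ′-form = trans (cong₂ (λ o′ d′ → ⁺ ((o′ * (o′ ∸ 1) * d′) / 2) - ⁺ wiener n₀′ k′ m′) same-order same-diameter)
                  (ℤ.m-n≡m⊖n c (wiener n₀′ k′ m′))

Near : ℕ → ℕ → Set
Near a b = a ≤ suc b × b ≤ suc a

pigeonhole : ∀ {a b c} → Near a b → Near b c → Near a c → a ≡ b ⊎ b ≡ c ⊎ a ≡ c
pigeonhole {a} {b} {c} (_ , b≤1+a) (b≤1+c , c≤1+b) (a≤1+c , c≤1+a) with <-cmp a b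
... | tri≈ _ a≡b _ = inj₁ a≡b
... | tri< a<b _ _ with <-cmp a c
...   | tri≈ _ a≡c _ = inj₂ (inj₂ a≡c)
...   | tri< a<c _ _ = inj₂ (inj₁ (trans (≤-antisym b≤1+a a<b) (sym (≤-antisym c≤1+a a<c))))
...   | tri> _ _ c<a = ⊥-elim (≤⇒≯ b≤1+c (≤-trans (s≤s c<a) a<b))
pigeonhole {a} {b} {c} (a≤1+b , _) (b≤1+c , c≤1+b) (a≤1+c , _) | tri> _ _ b<a with <-cmp b c
...   | tri≈ _ b≡c _ = inj₂ (inj₁ b≡c)
...   | tri< b<c _ _ = inj₂ (inj₂ (trans (≤-antisym a≤1+b b<a) (sym (≤-antisym c≤1+b b<c))))
...   | tri> _ _ c<b = ⊥-elim (≤⇒≯ a≤1+c (≤-trans (s≤s c<b) b<a))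

module Optimal (n₀ k : ℕ) (m : Fin k → ℕ) (k≥2 : 2 ≤ k) (m≥1 : ∀ i → 1 ≤ m i)
  (optimal : (n₀′ k′ : ℕ) (m′ : Fin k′ → ℕ) → 2 ≤ k′ → (∀ i → 1 ≤ m′ i) →
             order n₀′ k′ m′ ≡ order n₀ k m → diameter n₀′ k′ m′ ≡ 4 →
             Λ n₀ k m ≤ℤ Λ n₀′ k′ m′) where

  no-gap : ∀ i j → suc (m i) < m j → ⊥
  no-gap i j gap = ℤ.≤⇒≯ (optimal n₀ k m′ k≥2 m′≥1 (transfer-order n₀ m gap) diameter-T′)
                         (Λ-decreases {n₀} {k} {m} {n₀} {k} {m′} (transfer-order n₀ m gap)
                                      (trans diameter-T′ (sym diameter-T)) (transfer-wiener n₀ m gap))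
    where
    m′ : Fin k → ℕ
    m′ = transfer m i j
    m′≥1 : ∀ l → 1 ≤ m′ l
    m′≥1 = transfer-positive m (gap⇒≢ m gap) m≥1 (≤-trans (s≤s (s≤s z≤n)) gap)
    diameter-T : diameter n₀ k m ≡ 4
    diameter-T = diameter-four n₀ k m k≥2 m≥1
    diameter-T′ : diameter n₀ k m′ ≡ 4
    diameter-T′ = diameter-four n₀ k m′ k≥2 m′≥1

  near : ∀ i j → m j ≤ suc (m i)
  near i j with m j ≤? suc (m i)
  ... | yes m[j]≤1+m[i] = m[j]≤1+m[i]
  ... | no m[j]≰1+m[i] = ⊥-elim (no-gap i j (≰⇒> m[j]≰1+m[i]))

  at-most-two-values : ∀ i j l → m i ≡ m j ⊎ m j ≡ m l ⊎ m i ≡ m l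
  at-most-two-values i j l = pigeonhole (near j i , near i j) (near l j , near j l) (near l i , near i l)

  consecutive-values : ∀ i j → m i < m j → m j ≡ suc (m i)
  consecutive-values i j m[i]<m[j] = ≤-antisym (near i j) m[i]<m[j]

lemma3 : (n₀ k : ℕ) (m : Fin k → ℕ) → 2 ≤ k → (∀ i → 1 ≤ m i) →
         ((n₀' k' : ℕ) (m' : Fin k' → ℕ) → 2 ≤ k' → (∀ i → 1 ≤ m' i) →
            order n₀' k' m' ≡ order n₀ k m → diameter n₀' k' m' ≡ 4 →
            Λ n₀ k m ≤ℤ Λ n₀' k' m') →
         ((i j l : Fin k) → m i ≡ m j ⊎ m j ≡ m l ⊎ m i ≡ m l)
         × ((i j : Fin k) → m i < m j → m j ≡ suc (m i))
lemma3 n₀ k m k≥2 m≥1 optimal = at-most-two-values , consecutive-values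
  where open Optimal n₀ k m k≥2 m≥1 optimal
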